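{- Suppose there is a polynomial $P$ such that for every $n$ and every edge-coloring $f:E(K_n)\to\{A,B,C\}$ there is a 2-list covering for 3-CCP on $(K_n,f)$ of size at most $P(n)$. Then there is a polynomial $Q$ such that every graph on $n$ vertices has a CS-separator of size at most $Q(n)$.
   Context: 3-CCP: given an edge-coloring $f$ of $K_n$ with colors $\{A,B,C\}$, a solution is a vertex coloring $c$ with colors $\{A,B,C\}$ such that no edge $uv$ has $f(uv)=c(u)=c(v)$. A 2-list assignment assigns to each vertex a set of at most two colors; it is compatible with a solution $c$ if $c(x)$ belongs to the set of $x$ for every vertex $x$. A 2-list covering for 3-CCP on $(K_n,f)$ is a set of 2-list assignments such that every solution is compatible with at least one of them. A cut of a graph $G=(V,E)$ is a pair $(U,W)$ with $U\cup W=V$, $U\cap W=\emptyset$; it separates a clique $K$ and a stable set $S$ if $K\subseteq U$, $S\subseteq W$; a CS-separator is a family of cuts separating every clique from every stable set disjoint from it. -}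

module Defs where

open import Data.Nat using (ℕ; zero; suc; _+_; _*_; _≤_)
open import Data.Fin using (Fin)
open import Data.Bool using (Bool; true; false)
open import Data.List using (List; []; _∷_; length)
open import Data.List.Relation.Unary.All using (All)
open import Data.List.Relation.Unary.Any using (Any)
open import Data.Product using (Σ; ∃; _×_; _,_)
open import Relation.Nullary using (¬_)
open import Relation.Binary.PropositionalEquality using (_≡_; _≢_)

Poly : Set
Poly = List ℕ

eval : Poly → ℕ → ℕ
eval []       x = 0
eval (a ∷ as) x = a + x * eval as x

data Color : Set where
  A B C : Color

-- An edge-colouring of K_n: a symmetric colouring of ordered pairs
-- (only pairs u ≢ v are meaningful, i.e. the edges of K_n).
record EdgeColoring (n : ℕ) : Set where
  field
    col : Fin n → Fin n → Color
    sym : ∀ u v → col u v ≡ col v u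
open EdgeColoring public

IsSolution : ∀ {n} → EdgeColoring n → (Fin n → Color) → Set
IsSolution {n} f c =
  ∀ (u v : Fin n) → u ≢ v → ¬ (col f u v ≡ c u × c u ≡ c v)

ColorSet : Set
ColorSet = Color → Bool

AtMostTwo : ColorSet → Set
AtMostTwo s = ¬ (s A ≡ true × s B ≡ true × s C ≡ true)

ListAssignment : ℕ → Set
ListAssignment n = Fin n → ColorSet

Is2List : ∀ {n} → ListAssignment n → Set
Is2List {n} L = ∀ (x : Fin n) → AtMostTwo (L x)

Compatible : ∀ {n} → ListAssignment n → (Fin n → Color) → Set
Compatible {n} L c = ∀ (x : Fin n) → L x (c x) ≡ true

-- A 2-list covering for 3-CCP on (K_n, f) (a finite family, given as a list;
-- its size is its length).
Is2ListCovering : ∀ {n} → EdgeColoring n → List (ListAssignment n) → Set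
Is2ListCovering {n} f Ls =
  All Is2List Ls ×
  (∀ (c : Fin n → Color) → IsSolution f c → Any (λ L → Compatible L c) Ls)

record Graph (n : ℕ) : Set where
  field
    adj   : Fin n → Fin n → Bool
    sym   : ∀ u v → adj u v ≡ adj v u
    irref : ∀ u → adj u u ≡ false
open Graph public

VSet : ℕ → Set
VSet n = Fin n → Bool

IsClique : ∀ {n} → Graph n → VSet n → Set
IsClique {n} G K =
  ∀ (u v : Fin n) → K u ≡ true → K v ≡ true → u ≢ v → adj G u v ≡ true

IsStable : ∀ {n} → Graph n → VSet n → Set
IsStable {n} G S =
  ∀ (u v : Fin n) → S u ≡ true → S v ≡ true → u ≢ v → adj G u v ≡ false

Disjoint : ∀ {n} → VSet n → VSet n → Set
Disjoint {n} K S = ∀ (x : Fin n) → ¬ (K x ≡ true × S x ≡ true)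

-- A cut (U, W) with W = V \ U is determined by U : VSet n.
Cut : ℕ → Set
Cut = VSet

Separates : ∀ {n} → Cut n → VSet n → VSet n → Set
Separates {n} U K S =
  (∀ (x : Fin n) → K x ≡ true → U x ≡ true) ×
  (∀ (x : Fin n) → S x ≡ true → U x ≡ false)

IsCSSeparator : ∀ {n} → Graph n → List (Cut n) → Set
IsCSSeparator {n} G F =
  ∀ (K S : VSet n) → IsClique G K → IsStable G S → Disjoint K S →
  Any (λ U → Separates U K S) F

-- The graph G is encoded as the edge-colouring of K_n that colours edges B and non-edges A. For a
-- clique K and a disjoint stable set S, colouring K with A, S with B and the rest with C solves
-- 3-CCP, so some list assignment L of the covering is compatible with it. Then A ∉ L x excludes x
-- from K, B ∉ L x excludes x from S, and only on X = {x | A, B ∈ L x} is the side undetermined.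
-- Fix, depending on G and L only, a split partition of X: a clique K₀ with X ∖ K₀ stable (one
-- exists, namely K). A clique meets a stable set in at most one vertex, so K and K₀ differ on X
-- by at most a vertex a ∈ K ∩ (X ∖ K₀) and a vertex b ∈ K₀ ∩ S. Guessing a and b costs a factor
-- (n + 1)² per list assignment.
module Submission where

open import Defs hiding (sym)
open import Data.Bool using (true; false; _∧_; _∨_; not; if_then_else_)
open import Data.Bool.Properties using (∧-conicalˡ; ∧-conicalʳ) renaming (_≟_ to _≟ᵇ_)
open import Data.Fin using (Fin) renaming (_≟_ to _≟ᶠ_)
open import Data.Fin.Properties using (all?; any?)
open import Data.Fin.Subset.Properties using (anySubset?)
open import Data.List using (List; []; _∷_; length; map; allFin; cartesianProduct; cartesianProductWith)
open import Data.List.Properties using (length-++; length-map; length-tabulate)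
open import Data.List.Membership.Propositional using (_∈_; find; lose)
open import Data.List.Membership.Propositional.Properties
  using (∈-allFin; ∈-map⁺; ∈-cartesianProduct⁺; ∈-cartesianProductWith⁺)
open import Data.List.Relation.Unary.All as All using (All)
open import Data.List.Relation.Unary.Any using (here; there)
open import Data.Maybe using (Maybe; just; nothing)
open import Data.Maybe.Properties using (≡-dec)
open import Data.Nat using (ℕ; suc; _+_; _*_; _≤_)
open import Data.Nat.Properties using (+-identityʳ; *-monoˡ-≤; *-assoc; *-comm; module ≤-Reasoning)
open import Data.Nat.Solver using (module +-*-Solver)
open import Data.Product using (Σ; ∃; _×_; _,_; proj₁; proj₂)
open import Data.Vec using (lookup; tabulate)
open import Data.Vec.Properties using (lookup∘tabulate)
open import Function using (id)
open import Relation.Nullary using (Dec; yes; no; does; contradiction; ¬?; _×-dec_; _→-dec_)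
open import Relation.Nullary.Decidable using (dec-true; dec-false)
open import Relation.Binary.PropositionalEquality
  using (_≡_; _≢_; _≗_; refl; sym; trans; cong; cong₂; subst)

add : Poly → Poly → Poly
add []      q       = q
add p       []      = p
add (a ∷ p) (b ∷ q) = a + b ∷ add p q

eval-add : ∀ p q x → eval (add p q) x ≡ eval p x + eval q x
eval-add []      q       x = refl
eval-add (a ∷ p) []      x = sym (+-identityʳ _)
eval-add (a ∷ p) (b ∷ q) x rewrite eval-add p q x = solve 5
  (λ a b x u v → (a :+ b) :+ x :* (u :+ v) := (a :+ x :* u) :+ (b :+ x :* v))
  refl a b x (eval p x) (eval q x)
  where open +-*-Solver

mul-1+x : Poly → Poly
mul-1+x p = add p (0 ∷ p)

eval-mul-1+x : ∀ p x → eval (mul-1+x p) x ≡ suc x * eval p x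
eval-mul-1+x p x = eval-add p (0 ∷ p) x

length-cartesianProductWith : ∀ {a b c} {A : Set a} {B : Set b} {C : Set c}
  (f : A → B → C) xs ys → length (cartesianProductWith f xs ys) ≡ length xs * length ys
length-cartesianProductWith f []       ys = refl
length-cartesianProductWith f (x ∷ xs) ys = trans
  (length-++ (map (f x) ys))
  (cong₂ _+_ (length-map (f x) ys) (length-cartesianProductWith f xs ys))

maybeFins : ∀ n → List (Maybe (Fin n))
maybeFins n = nothing ∷ map just (allFin n)

length-maybeFins : ∀ n → length (maybeFins n) ≡ suc n
length-maybeFins n = cong suc (trans (length-map just (allFin n)) (length-tabulate id))

∈-maybeFins : ∀ {n} (m : Maybe (Fin n)) → m ∈ maybeFins n
∈-maybeFins nothing  = here refl
∈-maybeFins (just x) = there (∈-map⁺ just (∈-allFin x))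

module _ {n : ℕ} where

  infixl 6 _∖_
  infix  4 _⊆_

  _∖_ : VSet n → VSet n → VSet n
  (X ∖ Y) x = X x ∧ not (Y x)

  _⊆_ : VSet n → VSet n → Set
  X ⊆ Y = ∀ x → X x ≡ true → Y x ≡ true

  ∈-∖ : ∀ {X Y : VSet n} {x} → X x ≡ true → Y x ≡ false → (X ∖ Y) x ≡ true
  ∈-∖ Xx Yx rewrite Xx | Yx = refl

  ∖-congʳ : ∀ (X : VSet n) {Y Z} → Y ≗ Z → X ∖ Y ≗ X ∖ Z
  ∖-congʳ X Y≗Z x = cong (λ b → X x ∧ not b) (Y≗Z x)

  ≗⇒⊆ : ∀ {X Y : VSet n} → X ≗ Y → X ⊆ Y
  ≗⇒⊆ X≗Y x Xx = trans (sym (X≗Y x)) Xx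

  witness : ∀ {P : Fin n → Set} → Dec (∃ P) → Maybe (Fin n)
  witness (yes (x , _)) = just x
  witness (no _)        = nothing

  witness-sound : ∀ {P : Fin n → Set} (d : Dec (∃ P)) {x} → witness d ≡ just x → P x
  witness-sound (yes (x , Px)) refl = Px

  witness-complete : ∀ {P : Fin n → Set} (d : Dec (∃ P)) → (∀ {x y} → P x → P y → x ≡ y) →
    ∀ {x} → P x → witness d ≡ just x
  witness-complete (yes (y , Py)) unique Px = cong just (unique Py Px)
  witness-complete (no ∄P)        _      Px = contradiction (_ , Px) ∄P

  meet : VSet n → VSet n → Maybe (Fin n)
  meet K S = witness (any? λ x → (K x ≟ᵇ true) ×-dec (S x ≟ᵇ true))

  meet-sound : ∀ K S {x} → meet K S ≡ just x → K x ≡ true × S x ≡ true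
  meet-sound K S = witness-sound (any? λ x → (K x ≟ᵇ true) ×-dec (S x ≟ᵇ true))

module _ {n : ℕ} (G : Graph n) where

  isClique? : ∀ K → Dec (IsClique G K)
  isClique? K = all? λ u → all? λ v →
    (K u ≟ᵇ true) →-dec (K v ≟ᵇ true) →-dec ¬? (u ≟ᶠ v) →-dec (adj G u v ≟ᵇ true)

  isStable? : ∀ S → Dec (IsStable G S)
  isStable? S = all? λ u → all? λ v →
    (S u ≟ᵇ true) →-dec (S v ≟ᵇ true) →-dec ¬? (u ≟ᶠ v) →-dec (adj G u v ≟ᵇ false)

  isClique-⊆ : ∀ {K K′} → K′ ⊆ K → IsClique G K → IsClique G K′
  isClique-⊆ K′⊆K clique u v K′u K′v = clique u v (K′⊆K u K′u) (K′⊆K v K′v)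

  isStable-⊆ : ∀ {S S′} → S′ ⊆ S → IsStable G S → IsStable G S′
  isStable-⊆ S′⊆S stable u v S′u S′v = stable u v (S′⊆S u S′u) (S′⊆S v S′v)

  clique∩stable-unique : ∀ {K S} → IsClique G K → IsStable G S →
    ∀ {x y} → K x ≡ true × S x ≡ true → K y ≡ true × S y ≡ true → x ≡ y
  clique∩stable-unique clique stable {x} {y} (Kx , Sx) (Ky , Sy) with x ≟ᶠ y
  ... | yes x≡y = x≡y
  ... | no  x≢y = contradiction
    (trans (sym (clique x y Kx Ky x≢y)) (stable x y Sx Sy x≢y)) λ ()

  meet-complete : ∀ {K S} → IsClique G K → IsStable G S →
    ∀ {x} → K x ≡ true → S x ≡ true → meet K S ≡ just x
  meet-complete {K} {S} clique stable Kx Sx =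
    witness-complete (any? λ x → (K x ≟ᵇ true) ×-dec (S x ≟ᵇ true))
      (clique∩stable-unique clique stable) (Kx , Sx)

  IsSplitPartition : VSet n → VSet n → Set
  IsSplitPartition X K₀ = IsClique G K₀ × IsStable G (X ∖ K₀)

  isSplitPartition? : ∀ X K₀ → Dec (IsSplitPartition X K₀)
  isSplitPartition? X K₀ = isClique? K₀ ×-dec isStable? (X ∖ K₀)

  isSplitPartition-resp-≗ : ∀ X {K₀ K₁} → K₀ ≗ K₁ →
    IsSplitPartition X K₀ → IsSplitPartition X K₁
  isSplitPartition-resp-≗ X K₀≗K₁ (clique , stable) =
    isClique-⊆ (≗⇒⊆ (λ x → sym (K₀≗K₁ x))) clique ,
    isStable-⊆ (≗⇒⊆ (∖-congʳ X (λ x → sym (K₀≗K₁ x)))) stable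

  splitPartition : VSet n → VSet n
  splitPartition X = chosen (anySubset? λ s → isSplitPartition? X (lookup s))
    where
    chosen : Dec (∃ λ s → IsSplitPartition X (lookup s)) → VSet n
    chosen (yes (s , _)) = lookup s
    chosen (no _)        = λ _ → false

  splitPartition-correct : ∀ X {K₀} → IsSplitPartition X K₀ → IsSplitPartition X (splitPartition X)
  splitPartition-correct X {K₀} split with anySubset? (λ s → isSplitPartition? X (lookup s))
  ... | yes (_ , split′) = split′
  ... | no  ∄split       = contradiction
    (tabulate K₀ , isSplitPartition-resp-≗ X (λ x → sym (lookup∘tabulate K₀ x)) split) ∄split

adjacencyColoring : ∀ {n} → Graph n → EdgeColoring n
adjacencyColoring G = record
  { col = λ u v → if adj G u v then B else A
  ; sym = λ u v → cong (if_then B else A) (Graph.sym G u v)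
  }

cliqueStableColoring : ∀ {n} → VSet n → VSet n → Fin n → Color
cliqueStableColoring K S x = if K x then A else if S x then B else C

module _ {n : ℕ} {K S : VSet n} where

  private
    c : Fin n → Color
    c = cliqueStableColoring K S

  colored-A : ∀ x → c x ≡ A → K x ≡ true
  colored-A x cx≡A with K x | S x
  colored-A x refl    | true  | _     = refl
  colored-A x ()      | false | true
  colored-A x ()      | false | false

  colored-B : ∀ x → c x ≡ B → S x ≡ true
  colored-B x cx≡B with K x | S x
  colored-B x ()      | true  | _
  colored-B x refl    | false | true  = refl
  colored-B x ()      | false | false

  cliqueStableColoring-isSolution : (G : Graph n) → IsClique G K → IsStable G S →
    IsSolution (adjacencyColoring G) c
  cliqueStableColoring-isSolution G clique stable u v u≢v (f≡cu , cu≡cv) with adj G u v in uv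
  ... | true  = contradiction (trans (sym uv) (stable u v
    (colored-B u (sym f≡cu)) (colored-B v (sym (trans f≡cu cu≡cv))) u≢v)) λ ()
  ... | false = contradiction (trans (sym (clique u v
    (colored-A u (sym f≡cu)) (colored-A v (sym (trans f≡cu cu≡cv))) u≢v)) uv) λ ()

ambiguous : ∀ {n} → ListAssignment n → VSet n
ambiguous L x = L x A ∧ L x B

∈-ambiguous : ∀ {n} {L : ListAssignment n} {x} → L x A ≡ true → L x B ≡ true → ambiguous L x ≡ true
∈-ambiguous LxA LxB rewrite LxA | LxB = refl

module _ {n : ℕ} {K S : VSet n} {L : ListAssignment n}
         (disjoint : Disjoint K S) (compatible : Compatible L (cliqueStableColoring K S)) where

  S⊆∁K : ∀ x → S x ≡ true → K x ≡ false
  S⊆∁K x Sx with K x in Kx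
  ... | true  = contradiction (Kx , Sx) (disjoint x)
  ... | false = refl

  compatible-K : ∀ x → K x ≡ true → L x A ≡ true
  compatible-K x Kx = subst (λ col → L x col ≡ true) (coloring-K Kx) (compatible x)
    where
    coloring-K : K x ≡ true → cliqueStableColoring K S x ≡ A
    coloring-K Kx rewrite Kx = refl

  compatible-S : ∀ x → S x ≡ true → L x B ≡ true
  compatible-S x Sx = subst (λ col → L x col ≡ true) (coloring-S (S⊆∁K x Sx) Sx) (compatible x)
    where
    coloring-S : K x ≡ false → S x ≡ true → cliqueStableColoring K S x ≡ B
    coloring-S Kx Sx rewrite Kx | Sx = refl

  ambiguous∖K⊆S : Is2List L → ambiguous L ∖ K ⊆ S
  ambiguous∖K⊆S two x member = in-S (∧-conicalˡ _ _ amb) (∧-conicalʳ _ _ amb) (∧-conicalʳ _ _ member)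
    where
    amb : ambiguous L x ≡ true
    amb = ∧-conicalˡ _ _ member
    in-S : L x A ≡ true → L x B ≡ true → not (K x) ≡ true → S x ≡ true
    in-S LxA LxB ¬Kx with K x | S x | compatible x
    in-S LxA LxB () | true  | _     | _
    in-S LxA LxB _  | false | true  | _   = refl
    in-S LxA LxB _  | false | false | LxC = contradiction (LxA , LxB , LxC) (two x)

module _ {n : ℕ} (L : ListAssignment n) (K₀ : VSet n) where

  private
    _≟ₘ_ : (a b : Maybe (Fin n)) → Dec (a ≡ b)
    _≟ₘ_ = ≡-dec _≟ᶠ_

  splitCut : Maybe (Fin n) × Maybe (Fin n) → Cut n
  splitCut (a , b) x =
    L x A ∧ (not (L x B) ∨ (K₀ x ∧ not (does (b ≟ₘ just x))) ∨ does (a ≟ₘ just x))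

  splitCut-true : ∀ {a b x} → L x A ≡ true →
    (L x B ≡ true → K₀ x ≡ true → b ≢ just x) →
    (L x B ≡ true → K₀ x ≡ false → a ≡ just x) →
    splitCut (a , b) x ≡ true
  splitCut-true {a} {b} {x} LxA b≢x a≡x with L x A | L x B | K₀ x
  ... | true  | false | _     = refl
  ... | true  | true  | true  rewrite dec-false (b ≟ₘ just x) (b≢x refl refl) = refl
  ... | true  | true  | false rewrite dec-true  (a ≟ₘ just x) (a≡x refl refl) = refl
  splitCut-true () _ _ | false | _ | _

  splitCut-false : ∀ {a b x} → L x B ≡ true →
    (L x A ≡ true → a ≢ just x) →
    (L x A ≡ true → K₀ x ≡ true → b ≡ just x) →
    splitCut (a , b) x ≡ false
  splitCut-false {a} {b} {x} LxB a≢x b≡x with L x A | L x B | K₀ x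
  ... | false | _    | _     = refl
  ... | true  | true | true
    rewrite dec-false (a ≟ₘ just x) (a≢x refl) | dec-true (b ≟ₘ just x) (b≡x refl refl) = refl
  ... | true  | true | false rewrite dec-false (a ≟ₘ just x) (a≢x refl) = refl
  splitCut-false () _ _ | true | false | _

module _ {n : ℕ} (G : Graph n) {K S : VSet n} {L : ListAssignment n}
         (clique : IsClique G K) (stable : IsStable G S) (disjoint : Disjoint K S)
         (compatible : Compatible L (cliqueStableColoring K S)) where

  K-isSplitPartition : Is2List L → IsSplitPartition G (ambiguous L) K
  K-isSplitPartition two = clique , isStable-⊆ G (ambiguous∖K⊆S {L = L} disjoint compatible two) stable

  splitCut-separates : ∀ {K₀} → IsSplitPartition G (ambiguous L) K₀ →
    ∃ λ ab → Separates (splitCut L K₀ ab) K S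
  splitCut-separates {K₀} (K₀-clique , ambiguous∖K₀-stable) = (a , b) , K⊆U , S⊆W
    where
    a b : Maybe (Fin n)
    a = meet K (ambiguous L ∖ K₀)
    b = meet K₀ S

    K⊆U : ∀ x → K x ≡ true → splitCut L K₀ (a , b) x ≡ true
    K⊆U x Kx = splitCut-true L K₀ {a} {b} LxA
      (λ _ _ b≡x → disjoint x (Kx , proj₂ (meet-sound K₀ S b≡x)))
      (λ LxB K₀x → meet-complete G clique ambiguous∖K₀-stable Kx
        (∈-∖ {X = ambiguous L} {K₀} (∈-ambiguous {L = L} LxA LxB) K₀x))
      where
      LxA : L x A ≡ true
      LxA = compatible-K {L = L} disjoint compatible x Kx

    S⊆W : ∀ x → S x ≡ true → splitCut L K₀ (a , b) x ≡ false
    S⊆W x Sx = splitCut-false L K₀ {a} {b} (compatible-S {L = L} disjoint compatible x Sx)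
      (λ _ a≡x → disjoint x (proj₁ (meet-sound K (ambiguous L ∖ K₀) a≡x) , Sx))
      (λ _ K₀x → meet-complete G K₀-clique stable K₀x Sx)

labels : ∀ n → List (Maybe (Fin n) × Maybe (Fin n))
labels n = cartesianProduct (maybeFins n) (maybeFins n)

module _ {n : ℕ} (G : Graph n) where

  canonicalCut : ListAssignment n → Maybe (Fin n) × Maybe (Fin n) → Cut n
  canonicalCut L = splitCut L (splitPartition G (ambiguous L))

  csSeparator : List (ListAssignment n) → List (Cut n)
  csSeparator Ls = cartesianProductWith canonicalCut Ls (labels n)

  csSeparator-isCSSeparator : ∀ {Ls} → Is2ListCovering (adjacencyColoring G) Ls →
    IsCSSeparator G (csSeparator Ls)
  csSeparator-isCSSeparator (all2List , covers) K S clique stable disjoint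
    with find (covers (cliqueStableColoring K S) (cliqueStableColoring-isSolution G clique stable))
  ... | L , L∈Ls , compatible
    with splitCut-separates G {L = L} clique stable disjoint compatible
           (splitPartition-correct G (ambiguous L)
             (K-isSplitPartition G {L = L} clique stable disjoint compatible (All.lookup all2List L∈Ls)))
  ... | (a , b) , separates = lose
    (∈-cartesianProductWith⁺ canonicalCut L∈Ls (∈-cartesianProduct⁺ (∈-maybeFins a) (∈-maybeFins b)))
    separates

  length-csSeparator : ∀ Ls → length (csSeparator Ls) ≡ length Ls * (suc n * suc n)
  length-csSeparator Ls = trans (length-cartesianProductWith canonicalCut Ls (labels n))
    (cong (length Ls *_) (trans (length-cartesianProductWith _,_ (maybeFins n) (maybeFins n))
      (cong₂ _*_ (length-maybeFins n) (length-maybeFins n))))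

lemma28 : Σ Poly (λ P → ∀ (n : ℕ) (f : EdgeColoring n) → Σ (List (ListAssignment n)) (λ Ls → Is2ListCovering f Ls × length Ls ≤ eval P n))
    → Σ Poly (λ Q → ∀ (n : ℕ) (G : Graph n) → Σ (List (Cut n)) (λ F → IsCSSeparator G F × length F ≤ eval Q n))
lemma28 (P , coverings) = mul-1+x (mul-1+x P) , separator
  where
  separator : ∀ n (G : Graph n) → Σ (List (Cut n)) λ F →
    IsCSSeparator G F × length F ≤ eval (mul-1+x (mul-1+x P)) n
  separator n G with coverings n (adjacencyColoring G)
  ... | Ls , isCovering , |Ls|≤P = csSeparator G Ls , csSeparator-isCSSeparator G isCovering , (begin
    length (csSeparator G Ls)           ≡⟨ length-csSeparator G Ls ⟩
    length Ls * (suc n * suc n)         ≤⟨ *-monoˡ-≤ (suc n * suc n) |Ls|≤P ⟩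
    eval P n * (suc n * suc n)          ≡⟨ *-comm (eval P n) _ ⟩
    suc n * suc n * eval P n            ≡⟨ *-assoc (suc n) (suc n) (eval P n) ⟩
    suc n * (suc n * eval P n)          ≡⟨ cong (suc n *_) (sym (eval-mul-1+x P n)) ⟩
    suc n * eval (mul-1+x P) n          ≡⟨ sym (eval-mul-1+x (mul-1+x P) n) ⟩
    eval (mul-1+x (mul-1+x P)) n        ∎)
    where open ≤-Reasoning
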